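{- The functor $V:\mathrm{Syn}(\mathsf{Glob})\to\mathbf{FinGSet}^{op}$ is an equivalence of categories between the syntactic category of $\mathsf{Glob}$ and the opposite of the category of finite globular sets.
   Context: The type theory $\mathsf{Glob}$: terms are variables only; types are $\star$ or $t\to_A u$; contexts are lists $(x_1:A_1,\dots,x_n:A_n)$ and substitutions lists $\langle x_i\mapsto t_i\rangle$, acting on types by replacing variables. Rules: empty context valid; $\Gamma\vdash A$ with $x\notin\mathrm{Var}\Gamma$ gives $(\Gamma,x:A)\vdash$; $\Gamma\vdash$ gives $\Gamma\vdash\star$; $\Gamma\vdash A$, $\Gamma\vdash t:A$, $\Gamma\vdash u:A$ give $\Gamma\vdash t\to_Au$; $\Gamma\vdash$ and $(x:A)\in\Gamma$ give $\Gamma\vdash x:A$; $\Delta\vdash$ gives $\Delta\vdash\langle\rangle:()$; $\Delta\vdash\gamma:\Gamma$, $(\Gamma,x:A)\vdash$, $\Delta\vdash t:A[\gamma]$ give $\Delta\vdash\langle\gamma,x\mapsto t\rangle:(\Gamma,x:A)$. $\mathrm{Syn}(\mathsf{Glob})$ has derivable contexts (up to renaming of variables) as objects and derivable substitutions $\Delta\vdash\gamma:\Gamma$ as morphisms $\Delta\to\Gamma$, with composition $\langle x_i\mapsto t_i\rangle\circ\gamma=\langle x_i\mapsto t_i[\gamma]\rangle$. $\dim\star=-1$, $\dim(t\to_Au)=\dim A+1$. Globular sets are presheaves on the category of globes $\mathbb G$ (objects $n\in\mathbb N$, generators $\sigma_i,\tau_i:i\to i+1$, relations $\sigma_{i+1}\sigma_i=\tau_{i+1}\sigma_i$,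 $\sigma_{i+1}\tau_i=\tau_{i+1}\tau_i$), i.e. sets $G_n$ with $s,t:G_{n+1}\to G_n$ satisfying $ss=st$, $ts=tt$; $\mathbf{FinGSet}$ is the full subcategory of those with finitely many elements in total. $V$ sends $\Gamma=(x_i:A_i)$ to the globular set with $(V\Gamma)_n=\{x_i:\dim A_i=n-1\}$, where for $x:y\to z$ one sets $s(x)=y$, $t(x)=z$, and sends $\Delta\vdash\langle x_i\mapsto t_i\rangle:\Gamma$ to the morphism $V\Gamma\to V\Delta$, $x_i\mapsto t_i$. -}

module Defs where

open import Data.Nat using (ℕ; zero; suc; _<_; s≤s; z≤n)
open import Data.Nat.Properties using (_≟_; ≡-irrelevant; <⇒≢; n<1+n; m<n⇒m<1+n; ≤-refl)
open import Data.Fin using (Fin; toℕ; fromℕ<)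
open import Data.Fin.Properties using (toℕ-fromℕ<; toℕ-injective; toℕ<n)
open import Data.Product using (Σ; Σ-syntax; _×_; _,_; proj₁; proj₂)
import Data.Sum
import Data.Nat.Properties
open import Data.Empty using (⊥-elim)
open import Relation.Nullary using (yes; no)
open import Relation.Binary.PropositionalEquality
  using (_≡_; refl; sym; trans; cong; subst)
open import Function.Bundles using (_↔_; mk↔ₛ′)

-- Terms are variables only.  Variables are natural numbers; since the
-- objects of Syn(Glob) are contexts up to renaming of variables, we fix
-- the canonical naming: the i-th variable of a context (counting from 0,
-- from the left) is named i.  Thus every context (x₀:A₀,…,x_{n-1}:A_{n-1})
-- is represented by the list of its types, and the freshness side
-- condition  x ∉ Var Γ  of the context-extension rule is automatic.

data Ty : Set where
  ⋆     : Ty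
  _⇒[_]_ : ℕ → Ty → ℕ → Ty

data Ctx : Set where
  ∅   : Ctx
  _▸_ : Ctx → Ty → Ctx

len : Ctx → ℕ
len ∅       = 0
len (Γ ▸ _) = suc (len Γ)

data Sub : Set where
  ⟨⟩  : Sub
  _▹_ : Sub → ℕ → Sub

slen : Sub → ℕ
slen ⟨⟩      = 0
slen (γ ▹ _) = suc (slen γ)

-- the term that γ assigns to the variable x (x itself if x is not in
-- the domain of γ; this never happens for derivable data)
app : Sub → ℕ → ℕ
app ⟨⟩      x = x
app (γ ▹ t) x with x ≟ slen γ
... | yes _ = t
... | no  _ = app γ x

_[_] : Ty → Sub → Ty
⋆ [ γ ]           = ⋆
(t ⇒[ A ] u) [ γ ] = app γ t ⇒[ A [ γ ] ] app γ u

_∘s_ : Sub → Sub → Sub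
⟨⟩      ∘s δ = ⟨⟩
(γ ▹ t) ∘s δ = (γ ∘s δ) ▹ app δ t

idS : ℕ → Sub
idS zero    = ⟨⟩
idS (suc n) = idS n ▹ n

data _∋_⦂_ : Ctx → ℕ → Ty → Set where
  here  : ∀ {Γ A} → (Γ ▸ A) ∋ len Γ ⦂ A
  there : ∀ {Γ x A B} → Γ ∋ x ⦂ A → (Γ ▸ B) ∋ x ⦂ A

data _⊢ : Ctx → Set
data _⊢ty_ : Ctx → Ty → Set
data _⊢_⦂_ : Ctx → ℕ → Ty → Set

data _⊢ where
  ∅⊢ : ∅ ⊢
  ▸⊢ : ∀ {Γ A} → Γ ⊢ty A → (Γ ▸ A) ⊢

data _⊢ty_ where
  ⋆⊢ : ∀ {Γ} → Γ ⊢ → Γ ⊢ty ⋆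
  ⇒⊢ : ∀ {Γ A t u} → Γ ⊢ty A → Γ ⊢ t ⦂ A → Γ ⊢ u ⦂ A → Γ ⊢ty (t ⇒[ A ] u)

data _⊢_⦂_ where
  var⊢ : ∀ {Γ x A} → Γ ⊢ → Γ ∋ x ⦂ A → Γ ⊢ x ⦂ A

data _⊢s_⦂_ : Ctx → Sub → Ctx → Set where
  ⟨⟩⊢ : ∀ {Δ} → Δ ⊢ → Δ ⊢s ⟨⟩ ⦂ ∅
  ▹⊢  : ∀ {Δ Γ γ A t} → Δ ⊢s γ ⦂ Γ → (Γ ▸ A) ⊢ → Δ ⊢ t ⦂ (A [ γ ]) →
        Δ ⊢s (γ ▹ t) ⦂ (Γ ▸ A)

-- Dimension.  dim⁺ A = dim A + 1 (so dim⁺ ⋆ = 0, as dim ⋆ = -1).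

dim⁺ : Ty → ℕ
dim⁺ ⋆            = 0
dim⁺ (_ ⇒[ A ] _) = suc (dim⁺ A)

record GSet : Set₁ where
  field
    Cell : ℕ → Set
    src  : ∀ {n} → Cell (suc n) → Cell n
    tgt  : ∀ {n} → Cell (suc n) → Cell n
    ss≡st : ∀ {n} (x : Cell (suc (suc n))) → src (src x) ≡ src (tgt x)
    ts≡tt : ∀ {n} (x : Cell (suc (suc n))) → tgt (src x) ≡ tgt (tgt x)
open GSet public

IsFinite : GSet → Set
IsFinite G = Σ[ N ∈ ℕ ] (Fin N ↔ Σ ℕ (Cell G))

record FinGSet : Set₁ where
  field
    gset   : GSet
    finite : IsFinite gset
open FinGSet public

record GHom (G H : GSet) : Set where
  field
    map   : ∀ {n} → Cell G n → Cell H n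
    map-s : ∀ {n} (x : Cell G (suc n)) → map (src G x) ≡ src H (map x)
    map-t : ∀ {n} (x : Cell G (suc n)) → map (tgt G x) ≡ tgt H (map x)
open GHom public

_≈G_ : ∀ {G H} → GHom G H → GHom G H → Set
f ≈G g = ∀ {n} x → map f {n} x ≡ map g {n} x

idG : ∀ {G} → GHom G G
idG = record { map = λ x → x ; map-s = λ _ → refl ; map-t = λ _ → refl }

_∘G_ : ∀ {G H K} → GHom H K → GHom G H → GHom G K
_∘G_ {G} {H} {K} g f = record
  { map   = λ x → map g (map f x)
  ; map-s = λ x → trans (cong (map g) (map-s f x)) (map-s g (map f x))
  ; map-t = λ x → trans (cong (map g) (map-t f x)) (map-t g (map f x)) }

-- isomorphisms in FinGSet (full subcategory of GSet)
record GIso (G H : GSet) : Set where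
  field
    to      : GHom G H
    from    : GHom H G
    from∘to : (from ∘G to) ≈G idG
    to∘from : (to ∘G from) ≈G idG

tyAt : Ctx → ℕ → Ty
tyAt ∅       x = ⋆
tyAt (Γ ▸ A) x with x ≟ len Γ
... | yes _ = A
... | no  _ = tyAt Γ x

src# tgt# : Ty → ℕ
src# ⋆            = 0
src# (t ⇒[ _ ] _) = t
tgt# ⋆            = 0
tgt# (_ ⇒[ _ ] u) = u

base : Ty → Ty
base ⋆            = ⋆
base (_ ⇒[ A ] _) = A

∋⇒tyAt : ∀ {Γ x A} → Γ ∋ x ⦂ A → (x < len Γ) × (tyAt Γ x ≡ A)
∋⇒tyAt {Γ ▸ A} here with len Γ ≟ len Γ
... | yes _ = n<1+n _ , refl
... | no ne = ⊥-elim (ne refl)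
∋⇒tyAt {Γ ▸ B} {x} (there m) with x ≟ len Γ | ∋⇒tyAt m
... | yes refl | lt , _ = ⊥-elim (<⇒≢ lt refl)
... | no _     | lt , e = m<n⇒m<1+n lt , e

tyAt⇒∋ : ∀ {Γ x} → x < len Γ → Γ ∋ x ⦂ tyAt Γ x
tyAt⇒∋ {Γ ▸ A} {x} lt with x ≟ len Γ
... | yes refl = here
tyAt⇒∋ {Γ ▸ A} {x} (s≤s lt) | no ne with Data.Nat.Properties.m≤n⇒m<n∨m≡n lt
... | Data.Sum.inj₁ l = there (tyAt⇒∋ l)
... | Data.Sum.inj₂ e = ⊥-elim (ne e)

ctx-of-ty : ∀ {Γ A} → Γ ⊢ty A → Γ ⊢
ctx-of-ty (⋆⊢ d)     = d
ctx-of-ty (⇒⊢ a _ _) = ctx-of-ty a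

wk-tm : ∀ {Γ B t A} → (Γ ▸ B) ⊢ → Γ ⊢ t ⦂ A → (Γ ▸ B) ⊢ t ⦂ A
wk-tm w (var⊢ _ m) = var⊢ w (there m)

wk-ty : ∀ {Γ B A} → (Γ ▸ B) ⊢ → Γ ⊢ty A → (Γ ▸ B) ⊢ty A
wk-ty w (⋆⊢ _)     = ⋆⊢ w
wk-ty w (⇒⊢ a t u) = ⇒⊢ (wk-ty w a) (wk-tm w t) (wk-tm w u)

∋⇒ty : ∀ {Γ x A} → Γ ⊢ → Γ ∋ x ⦂ A → Γ ⊢ty A
∋⇒ty d@(▸⊢ a) here      = wk-ty d a
∋⇒ty d@(▸⊢ b) (there m) = wk-ty d (∋⇒ty (ctx-of-ty b) m)

bnd : ∀ {Γ T m} → Γ ⊢ty T → dim⁺ T ≡ suc m →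
      ((src# T < len Γ) × (tyAt Γ (src# T) ≡ base T)) ×
      ((tgt# T < len Γ) × (tyAt Γ (tgt# T) ≡ base T))
bnd (⋆⊢ _) ()
bnd (⇒⊢ _ (var⊢ _ mt) (var⊢ _ mu)) _ = ∋⇒tyAt mt , ∋⇒tyAt mu

dim-base : ∀ {T m} → dim⁺ T ≡ suc m → dim⁺ (base T) ≡ m
dim-base {⋆} ()
dim-base {_ ⇒[ _ ] _} refl = refl

VCell : Ctx → ℕ → Set
VCell Γ n = Σ[ i ∈ Fin (len Γ) ] (dim⁺ (tyAt Γ (toℕ i)) ≡ n)

VCell-≡ : ∀ {Γ n} {c c' : VCell Γ n} → toℕ (proj₁ c) ≡ toℕ (proj₁ c') → c ≡ c'
VCell-≡ {c = i , p} {c' = j , q} e with toℕ-injective e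
... | refl with ≡-irrelevant p q
... | refl = refl

module _ {Γ : Ctx} (d : Γ ⊢) where
  private
    tyd : (i : Fin (len Γ)) → Γ ⊢ty tyAt Γ (toℕ i)
    tyd i = ∋⇒ty d (tyAt⇒∋ (toℕ<n i))

    mkCell : ∀ {m} x → x < len Γ → dim⁺ (tyAt Γ x) ≡ m → VCell Γ m
    mkCell x lt p = fromℕ< lt , subst (λ y → dim⁺ (tyAt Γ y) ≡ _) (sym (toℕ-fromℕ< lt)) p

  Vsrc : ∀ {m} → VCell Γ (suc m) → VCell Γ m
  Vsrc (i , p) = let ((lt , e) , _) = bnd (tyd i) p in
    mkCell _ lt (trans (cong dim⁺ e) (dim-base p))

  Vtgt : ∀ {m} → VCell Γ (suc m) → VCell Γ m
  Vtgt (i , p) = let (_ , (lt , e)) = bnd (tyd i) p in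
    mkCell _ lt (trans (cong dim⁺ e) (dim-base p))

  module _ where
    toℕ-src : ∀ {m} (c : VCell Γ (suc m)) →
              toℕ (proj₁ (Vsrc c)) ≡ src# (tyAt Γ (toℕ (proj₁ c)))
    toℕ-src (i , p) = toℕ-fromℕ< _
    toℕ-tgt : ∀ {m} (c : VCell Γ (suc m)) →
              toℕ (proj₁ (Vtgt c)) ≡ tgt# (tyAt Γ (toℕ (proj₁ c)))
    toℕ-tgt (i , p) = toℕ-fromℕ< _
    ty-src : ∀ {m} (c : VCell Γ (suc m)) →
             tyAt Γ (toℕ (proj₁ (Vsrc c))) ≡ base (tyAt Γ (toℕ (proj₁ c)))
    ty-src c@(i , p) = trans (cong (tyAt Γ) (toℕ-src c)) (proj₂ (proj₁ (bnd (tyd i) p)))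
    ty-tgt : ∀ {m} (c : VCell Γ (suc m)) →
             tyAt Γ (toℕ (proj₁ (Vtgt c))) ≡ base (tyAt Γ (toℕ (proj₁ c)))
    ty-tgt c@(i , p) = trans (cong (tyAt Γ) (toℕ-tgt c)) (proj₂ (proj₂ (bnd (tyd i) p)))

  Vss : ∀ {m} (c : VCell Γ (suc (suc m))) → Vsrc (Vsrc c) ≡ Vsrc (Vtgt c)
  Vss c = VCell-≡ (trans (toℕ-src (Vsrc c)) (trans (cong src# (ty-src c))
                  (sym (trans (toℕ-src (Vtgt c)) (cong src# (ty-tgt c))))))

  Vtt : ∀ {m} (c : VCell Γ (suc (suc m))) → Vtgt (Vsrc c) ≡ Vtgt (Vtgt c)
  Vtt c = VCell-≡ (trans (toℕ-tgt (Vsrc c)) (trans (cong tgt# (ty-src c))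
                  (sym (trans (toℕ-tgt (Vtgt c)) (cong tgt# (ty-tgt c))))))

  VG : GSet
  VG = record { Cell = VCell Γ ; src = Vsrc ; tgt = Vtgt ; ss≡st = Vss ; ts≡tt = Vtt }

  VFin : IsFinite VG
  VFin = len Γ , mk↔ₛ′ (λ i → dim⁺ (tyAt Γ (toℕ i)) , i , refl)
                        (λ c → proj₁ (proj₂ c))
                        (λ { (n , i , refl) → refl })
                        (λ i → refl)

V₀ : (Γ : Ctx) → Γ ⊢ → FinGSet
V₀ Γ d = record { gset = VG d ; finite = VFin d }

app-here : ∀ γ t → app (γ ▹ t) (slen γ) ≡ t
app-here γ t with slen γ ≟ slen γ
... | yes _ = refl
... | no ne = ⊥-elim (ne refl)

app-there : ∀ {γ t x} → x < slen γ → app (γ ▹ t) x ≡ app γ x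
app-there {γ} {t} {x} lt with x ≟ slen γ
... | yes e = ⊥-elim (<⇒≢ lt e)
... | no _  = refl

slen-len : ∀ {Δ γ Γ} → Δ ⊢s γ ⦂ Γ → slen γ ≡ len Γ
slen-len (⟨⟩⊢ _)     = refl
slen-len (▹⊢ dγ _ _) = cong suc (slen-len dγ)

scoped : ∀ {Γ A γ t} → Γ ⊢ty A → slen γ ≡ len Γ → A [ γ ▹ t ] ≡ A [ γ ]
scoped (⋆⊢ _) _ = refl
scoped {γ = γ} {t} (⇒⊢ a (var⊢ _ mt) (var⊢ _ mu)) e =
  cong₃ _⇒[_]_ (app-there {γ} {t} (subst (_ <_) (sym e) (proj₁ (∋⇒tyAt mt))))
               (scoped {γ = γ} {t} a e)
               (app-there {γ} {t} (subst (_ <_) (sym e) (proj₁ (∋⇒tyAt mu))))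
  where
  cong₃ : ∀ {A B C D : Set} (f : A → B → C → D) {a a' b b' c c'} →
          a ≡ a' → b ≡ b' → c ≡ c' → f a b c ≡ f a' b' c'
  cong₃ f refl refl refl = refl

sub-var : ∀ {Δ γ Γ x A} → Δ ⊢s γ ⦂ Γ → Γ ∋ x ⦂ A → Δ ⊢ app γ x ⦂ (A [ γ ])
sub-var {γ = γ ▹ t} (▹⊢ dγ w@(▸⊢ b) dt) here
  rewrite sym (slen-len dγ) | app-here γ t | scoped {γ = γ} {t} b (slen-len dγ) = dt
sub-var {γ = γ ▹ t} {x = x} {A} (▹⊢ dγ w@(▸⊢ b) dt) (there m)
  rewrite app-there {γ} {t} (subst (x <_) (sym (slen-len dγ)) (proj₁ (∋⇒tyAt m)))
        | scoped {γ = γ} {t} (∋⇒ty (ctx-of-ty b) m) (slen-len dγ) = sub-var dγ m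

dim-sub : ∀ A γ → dim⁺ (A [ γ ]) ≡ dim⁺ A
dim-sub ⋆ γ = refl
dim-sub (_ ⇒[ A ] _) γ = cong suc (dim-sub A γ)

src-sub : ∀ {T m} γ → dim⁺ T ≡ suc m → src# (T [ γ ]) ≡ app γ (src# T)
src-sub {⋆} γ ()
src-sub {_ ⇒[ _ ] _} γ _ = refl

tgt-sub : ∀ {T m} γ → dim⁺ T ≡ suc m → tgt# (T [ γ ]) ≡ app γ (tgt# T)
tgt-sub {⋆} γ ()
tgt-sub {_ ⇒[ _ ] _} γ _ = refl

module _ {Δ Γ : Ctx} {γ : Sub} (dΓ : Γ ⊢) (dΔ : Δ ⊢) (dγ : Δ ⊢s γ ⦂ Γ) where
  private
    inner : (i : Fin (len Γ)) → (app γ (toℕ i) < len Δ) ×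
            (tyAt Δ (app γ (toℕ i)) ≡ tyAt Γ (toℕ i) [ γ ])
    inner i with sub-var dγ (tyAt⇒∋ {Γ} (toℕ<n i))
    ... | var⊢ _ m = ∋⇒tyAt m

  Vmap : ∀ {n} → VCell Γ n → VCell Δ n
  Vmap (i , p) = fromℕ< (proj₁ (inner i)) ,
    subst (λ y → dim⁺ (tyAt Δ y) ≡ _) (sym (toℕ-fromℕ< (proj₁ (inner i))))
      (trans (cong dim⁺ (proj₂ (inner i))) (trans (dim-sub (tyAt Γ (toℕ i)) γ) p))

  private
    toℕ-Vmap : ∀ {n} (c : VCell Γ n) → toℕ (proj₁ (Vmap c)) ≡ app γ (toℕ (proj₁ c))
    toℕ-Vmap (i , p) = toℕ-fromℕ< _

  Vmap-s : ∀ {n} (c : VCell Γ (suc n)) → Vmap (Vsrc dΓ c) ≡ Vsrc dΔ (Vmap c)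
  Vmap-s c@(i , p) = VCell-≡ (trans (toℕ-Vmap (Vsrc dΓ c))
    (trans (cong (app γ) (toℕ-src dΓ c))
    (sym (trans (toℕ-src dΔ (Vmap c))
         (trans (cong (λ y → src# (tyAt Δ y)) (toℕ-Vmap c))
         (trans (cong src# (proj₂ (inner i))) (src-sub γ p)))))))

  Vmap-t : ∀ {n} (c : VCell Γ (suc n)) → Vmap (Vtgt dΓ c) ≡ Vtgt dΔ (Vmap c)
  Vmap-t c@(i , p) = VCell-≡ (trans (toℕ-Vmap (Vtgt dΓ c))
    (trans (cong (app γ) (toℕ-tgt dΓ c))
    (sym (trans (toℕ-tgt dΔ (Vmap c))
         (trans (cong (λ y → tgt# (tyAt Δ y)) (toℕ-Vmap c))
         (trans (cong tgt# (proj₂ (inner i))) (tgt-sub γ p)))))))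

V₁ : ∀ {Δ Γ γ} (dΓ : Γ ⊢) (dΔ : Δ ⊢) → Δ ⊢s γ ⦂ Γ →
     GHom (gset (V₀ Γ dΓ)) (gset (V₀ Δ dΔ))
V₁ dΓ dΔ dγ = record { map = Vmap dΓ dΔ dγ ; map-s = Vmap-s dΓ dΔ dγ ; map-t = Vmap-t dΓ dΔ dγ }

-- Syn(Glob): objects are derivable contexts (Γ , dΓ : Γ ⊢) with the
-- canonical variable names (= contexts up to renaming); morphisms
-- Δ → Γ are substitutions γ with Δ ⊢s γ ⦂ Γ, two morphisms being equal
-- iff the substitutions are equal.  Composition is _∘s_, identities idS.

record SynCategory&VFunctor : Set where
  field
    id-derivable : ∀ {Γ} → Γ ⊢ → Γ ⊢s idS (len Γ) ⦂ Γ
    ∘-derivable  : ∀ {Θ Δ Γ γ δ} → Δ ⊢s γ ⦂ Γ → Θ ⊢s δ ⦂ Δ → Θ ⊢s (γ ∘s δ) ⦂ Γ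
    V-id   : ∀ {Γ} (dΓ : Γ ⊢) (d : Γ ⊢s idS (len Γ) ⦂ Γ) → V₁ dΓ dΓ d ≈G idG
    V-comp : ∀ {Θ Δ Γ γ δ} (dΘ : Θ ⊢) (dΔ : Δ ⊢) (dΓ : Γ ⊢)
             (dγ : Δ ⊢s γ ⦂ Γ) (dδ : Θ ⊢s δ ⦂ Δ) (dγδ : Θ ⊢s (γ ∘s δ) ⦂ Γ) →
             V₁ dΓ dΘ dγδ ≈G (V₁ dΔ dΘ dδ ∘G V₁ dΓ dΔ dγ)

record VIsEquivalence : Set₁ where
  field
    faithful : ∀ {Δ Γ γ γ'} (dΓ : Γ ⊢) (dΔ : Δ ⊢)
               (dγ : Δ ⊢s γ ⦂ Γ) (dγ' : Δ ⊢s γ' ⦂ Γ) →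
               V₁ dΓ dΔ dγ ≈G V₁ dΓ dΔ dγ' → γ ≡ γ'
    full     : ∀ {Δ Γ} (dΓ : Γ ⊢) (dΔ : Δ ⊢)
               (f : GHom (gset (V₀ Γ dΓ)) (gset (V₀ Δ dΔ))) →
               Σ[ γ ∈ Sub ] Σ[ dγ ∈ Δ ⊢s γ ⦂ Γ ] (V₁ dΓ dΔ dγ ≈G f)
    ess-surj : (G : FinGSet) →
               Σ[ Γ ∈ Ctx ] Σ[ dΓ ∈ Γ ⊢ ] GIso (gset (V₀ Γ dΓ)) (gset G)

module Submission where

open import Defs
open import Data.Nat using (ℕ; zero; suc; _<_; _≤_; _<?_; _≤?_; s≤s; z≤n)
open import Data.Nat.Properties
  using (suc-injective; ≡-irrelevant; ≤-refl; ≤-trans; ≤-reflexive; <⇒≤; ≰⇒>; <-≤-trans; <-irrefl;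
         n<1+n; m<n⇒m<1+n; m<1+n⇒m<n∨m≡n)
open import Data.Fin as Fin using (Fin; toℕ; fromℕ<; punchIn) renaming (zero to fz; suc to fs)
open import Data.Fin.Properties using (toℕ-fromℕ<; fromℕ<-toℕ; toℕ-injective; toℕ<n)
open import Data.Fin.Permutation using (Permutation′; id; insert; _⟨$⟩ʳ_)
open import Data.Product using (Σ; Σ-syntax; _×_; _,_; proj₁; proj₂)
open import Data.Sum using (inj₁; inj₂)
open import Data.Empty using (⊥-elim)
open import Function.Base using (_∘_)
open import Function.Bundles using (_↔_; Inverse)
open import Function.Construct.Composition using (_↔-∘_)
open import Relation.Nullary using (yes; no)
open import Relation.Binary.PropositionalEquality
  using (_≡_; refl; sym; trans; cong; cong₂; subst; subst₂; module ≡-Reasoning)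

-- A derivable substitution Δ ⊢ γ : Γ is just the list of variables γ(xᵢ), and the typing
-- constraint γ(xᵢ) : Aᵢ[γ] says, by induction on the dimension of Aᵢ, precisely that
-- xᵢ ↦ γ(xᵢ) commutes with sources and targets; so V is fully faithful.  Conversely, listing
-- the cells of a finite globular set G in order of increasing dimension puts the source and
-- target of every cell before the cell itself, so giving the cell c of dimension n+1 the
-- type  s c →_{A} t c  (A the type of s c) yields a derivable context Γ with V Γ ≅ G.

⇒-cong : ∀ {t t′ A A′ u u′} → t ≡ t′ → A ≡ A′ → u ≡ u′ → t ⇒[ A ] u ≡ t′ ⇒[ A′ ] u′
⇒-cong refl refl refl = refl

⋆-η : ∀ {T} → dim⁺ T ≡ 0 → T ≡ ⋆
⋆-η {⋆} _ = refl

⇒-η : ∀ {T m} → dim⁺ T ≡ suc m → T ≡ src# T ⇒[ base T ] tgt# T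
⇒-η {_ ⇒[ _ ] _} _ = refl

var-bound : ∀ {Γ t A} → Γ ⊢ t ⦂ A → t < len Γ
var-bound (var⊢ _ m) = proj₁ (∋⇒tyAt m)

tabulate : (ℕ → ℕ) → ℕ → Sub
tabulate g zero    = ⟨⟩
tabulate g (suc n) = tabulate g n ▹ g n

slen-tabulate : ∀ g n → slen (tabulate g n) ≡ n
slen-tabulate g zero    = refl
slen-tabulate g (suc n) = cong suc (slen-tabulate g n)

app-tabulate : ∀ g n {x} → x < n → app (tabulate g n) x ≡ g x
app-tabulate g (suc n) {x} x<1+n with m<1+n⇒m<n∨m≡n x<1+n
... | inj₁ x<n  = trans (app-there (subst (x <_) (sym (slen-tabulate g n)) x<n)) (app-tabulate g n x<n)
... | inj₂ refl = subst (λ k → app (tabulate g x ▹ g x) k ≡ g x) (slen-tabulate g x)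
                    (app-here (tabulate g x) (g x))

tabulate-cong : ∀ {g h} n → (∀ {x} → x < n → g x ≡ h x) → tabulate g n ≡ tabulate h n
tabulate-cong zero    g≗h = refl
tabulate-cong (suc n) g≗h = cong₂ _▹_ (tabulate-cong n (g≗h ∘ m<n⇒m<1+n)) (g≗h (n<1+n n))

∘s-tabulate : ∀ γ δ → γ ∘s δ ≡ tabulate (app δ ∘ app γ) (slen γ)
∘s-tabulate ⟨⟩      δ = refl
∘s-tabulate (γ ▹ t) δ = cong₂ _▹_
  (trans (∘s-tabulate γ δ) (tabulate-cong (slen γ) (λ x<n → cong (app δ) (sym (app-there x<n)))))
  (cong (app δ) (sym (app-here γ t)))

∘s-⟨⟩ : ∀ γ → γ ∘s ⟨⟩ ≡ γ
∘s-⟨⟩ ⟨⟩      = refl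
∘s-⟨⟩ (γ ▹ t) = cong (_▹ t) (∘s-⟨⟩ γ)

slen-∘s : ∀ γ δ → slen (γ ∘s δ) ≡ slen γ
slen-∘s γ δ = trans (cong slen (∘s-tabulate γ δ)) (slen-tabulate _ _)

app-∘s : ∀ γ δ {x} → x < slen γ → app (γ ∘s δ) x ≡ app δ (app γ x)
app-∘s γ δ x<n = trans (cong (λ σ → app σ _) (∘s-tabulate γ δ)) (app-tabulate _ _ x<n)

sub-ext : ∀ {γ γ′ n} → slen γ ≡ n → slen γ′ ≡ n → (∀ {x} → x < n → app γ x ≡ app γ′ x) → γ ≡ γ′
sub-ext {γ} {γ′} refl eq′ γ≗γ′ = begin
  γ                             ≡⟨ sym (∘s-⟨⟩ γ) ⟩
  γ ∘s ⟨⟩                       ≡⟨ ∘s-tabulate γ ⟨⟩ ⟩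
  tabulate (app γ) (slen γ)     ≡⟨ tabulate-cong (slen γ) γ≗γ′ ⟩
  tabulate (app γ′) (slen γ)    ≡⟨ cong (tabulate (app γ′)) (sym eq′) ⟩
  tabulate (app γ′) (slen γ′)   ≡⟨ sym (∘s-tabulate γ′ ⟨⟩) ⟩
  γ′ ∘s ⟨⟩                      ≡⟨ ∘s-⟨⟩ γ′ ⟩
  γ′                            ∎
  where open ≡-Reasoning

idS-tabulate : ∀ n → idS n ≡ tabulate (λ x → x) n
idS-tabulate zero    = refl
idS-tabulate (suc n) = cong (_▹ n) (idS-tabulate n)

slen-idS : ∀ n → slen (idS n) ≡ n
slen-idS n = trans (cong slen (idS-tabulate n)) (slen-tabulate _ n)

app-idS : ∀ n {x} → x < n → app (idS n) x ≡ x
app-idS n x<n = trans (cong (λ σ → app σ _) (idS-tabulate n)) (app-tabulate _ n x<n)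

[]-cong : ∀ {Γ A γ γ′} → Γ ⊢ty A → (∀ {x} → x < len Γ → app γ x ≡ app γ′ x) → A [ γ ] ≡ A [ γ′ ]
[]-cong (⋆⊢ _)     γ≗γ′ = refl
[]-cong (⇒⊢ a t u) γ≗γ′ = ⇒-cong (γ≗γ′ (var-bound t)) ([]-cong a γ≗γ′) (γ≗γ′ (var-bound u))

[]-⟨⟩ : ∀ A → A [ ⟨⟩ ] ≡ A
[]-⟨⟩ ⋆            = refl
[]-⟨⟩ (t ⇒[ A ] u) = cong (λ B → t ⇒[ B ] u) ([]-⟨⟩ A)

[]-idS : ∀ {Γ A} → Γ ⊢ty A → A [ idS (len Γ) ] ≡ A
[]-idS {A = A} a = trans ([]-cong a (app-idS _)) ([]-⟨⟩ A)

[]-∘s : ∀ {Γ A γ} δ → Γ ⊢ty A → slen γ ≡ len Γ → A [ γ ∘s δ ] ≡ A [ γ ] [ δ ]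
[]-∘s δ (⋆⊢ _) _ = refl
[]-∘s {Γ} {γ = γ} δ (⇒⊢ a t u) eq =
  ⇒-cong (app-∘s γ δ (bound t)) ([]-∘s δ a eq) (app-∘s γ δ (bound u))
  where
  bound : ∀ {x B} → Γ ⊢ x ⦂ B → x < slen γ
  bound d = subst (_ <_) (sym eq) (var-bound d)

⊢s⇒dom⊢ : ∀ {Δ γ Γ} → Δ ⊢s γ ⦂ Γ → Δ ⊢
⊢s⇒dom⊢ (⟨⟩⊢ dΔ)     = dΔ
⊢s⇒dom⊢ (▹⊢ dγ _ _) = ⊢s⇒dom⊢ dγ

⊢s⇒cod⊢ : ∀ {Δ γ Γ} → Δ ⊢s γ ⦂ Γ → Γ ⊢
⊢s⇒cod⊢ (⟨⟩⊢ _)     = ∅⊢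
⊢s⇒cod⊢ (▹⊢ _ dΓ _) = dΓ

⊢s-intro : ∀ {Δ Γ γ} → Δ ⊢ → Γ ⊢ → slen γ ≡ len Γ →
           (∀ {x A} → Γ ∋ x ⦂ A → Δ ⊢ app γ x ⦂ (A [ γ ])) → Δ ⊢s γ ⦂ Γ
⊢s-intro {Γ = ∅}     {⟨⟩}    dΔ _ _ _ = ⟨⟩⊢ dΔ
⊢s-intro {Δ} {Γ ▸ A} {γ ▹ t} dΔ dΓA@(▸⊢ a) eq typed =
  ▹⊢ (⊢s-intro dΔ (ctx-of-ty a) eq′ typed′) dΓA
     (subst₂ (Δ ⊢_⦂_) (trans (cong (app (γ ▹ t)) (sym eq′)) (app-here γ t)) (scoped a eq′) (typed here))
  where
  eq′ = suc-injective eq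
  typed′ : ∀ {x B} → Γ ∋ x ⦂ B → Δ ⊢ app γ x ⦂ (B [ γ ])
  typed′ m = subst₂ (Δ ⊢_⦂_) (app-there (subst (_ <_) (sym eq′) (proj₁ (∋⇒tyAt m))))
                            (scoped (∋⇒ty (ctx-of-ty a) m) eq′) (typed (there m))

sub-tm : ∀ {Δ γ Γ t A} → Δ ⊢s γ ⦂ Γ → Γ ⊢ t ⦂ A → Δ ⊢ app γ t ⦂ (A [ γ ])
sub-tm dγ (var⊢ _ m) = sub-var dγ m

idS-derivable : ∀ {Γ} → Γ ⊢ → Γ ⊢s idS (len Γ) ⦂ Γ
idS-derivable {Γ} dΓ = ⊢s-intro dΓ dΓ (slen-idS _) λ m →
  subst₂ (Γ ⊢_⦂_) (sym (app-idS _ (proj₁ (∋⇒tyAt m)))) (sym ([]-idS (∋⇒ty dΓ m))) (var⊢ dΓ m)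

∘s-derivable : ∀ {Θ Δ Γ γ δ} → Δ ⊢s γ ⦂ Γ → Θ ⊢s δ ⦂ Δ → Θ ⊢s (γ ∘s δ) ⦂ Γ
∘s-derivable {Θ} {γ = γ} {δ} dγ dδ =
  ⊢s-intro (⊢s⇒dom⊢ dδ) (⊢s⇒cod⊢ dγ) (trans (slen-∘s γ δ) (slen-len dγ)) λ m →
    subst₂ (Θ ⊢_⦂_)
      (sym (app-∘s γ δ (subst (_ <_) (sym (slen-len dγ)) (proj₁ (∋⇒tyAt m)))))
      (sym ([]-∘s δ (∋⇒ty (⊢s⇒cod⊢ dγ) m) (slen-len dγ)))
      (sub-tm dδ (sub-var dγ m))

toℕ-Vmap : ∀ {Δ Γ γ} (dΓ : Γ ⊢) (dΔ : Δ ⊢) (dγ : Δ ⊢s γ ⦂ Γ) {n} (c : VCell Γ n) →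
           toℕ (proj₁ (Vmap dΓ dΔ dγ c)) ≡ app γ (toℕ (proj₁ c))
toℕ-Vmap _ _ _ _ = toℕ-fromℕ< _

V-id : ∀ {Γ} (dΓ : Γ ⊢) (d : Γ ⊢s idS (len Γ) ⦂ Γ) → V₁ dΓ dΓ d ≈G idG
V-id dΓ d c = VCell-≡ (trans (toℕ-Vmap dΓ dΓ d c) (app-idS _ (toℕ<n (proj₁ c))))

V-comp : ∀ {Θ Δ Γ γ δ} (dΘ : Θ ⊢) (dΔ : Δ ⊢) (dΓ : Γ ⊢)
         (dγ : Δ ⊢s γ ⦂ Γ) (dδ : Θ ⊢s δ ⦂ Δ) (dγδ : Θ ⊢s (γ ∘s δ) ⦂ Γ) →
         V₁ dΓ dΘ dγδ ≈G (V₁ dΔ dΘ dδ ∘G V₁ dΓ dΔ dγ)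
V-comp {γ = γ} {δ} dΘ dΔ dΓ dγ dδ dγδ c = VCell-≡ (begin
  toℕ (proj₁ (Vmap dΓ dΘ dγδ c))                     ≡⟨ toℕ-Vmap dΓ dΘ dγδ c ⟩
  app (γ ∘s δ) (toℕ (proj₁ c))                       ≡⟨ app-∘s γ δ (subst (_ <_) (sym (slen-len dγ)) (toℕ<n (proj₁ c))) ⟩
  app δ (app γ (toℕ (proj₁ c)))                      ≡⟨ cong (app δ) (toℕ-Vmap dΓ dΔ dγ c) ⟨
  app δ (toℕ (proj₁ (Vmap dΓ dΔ dγ c)))              ≡⟨ toℕ-Vmap dΔ dΘ dδ (Vmap dΓ dΔ dγ c) ⟨
  toℕ (proj₁ (Vmap dΔ dΘ dδ (Vmap dΓ dΔ dγ c)))      ∎)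
  where open ≡-Reasoning

synCategory&V : SynCategory&VFunctor
synCategory&V = record
  { id-derivable = idS-derivable
  ; ∘-derivable  = ∘s-derivable
  ; V-id         = V-id
  ; V-comp       = V-comp
  }

V-faithful : ∀ {Δ Γ γ γ′} (dΓ : Γ ⊢) (dΔ : Δ ⊢) (dγ : Δ ⊢s γ ⦂ Γ) (dγ′ : Δ ⊢s γ′ ⦂ Γ) →
             V₁ dΓ dΔ dγ ≈G V₁ dΓ dΔ dγ′ → γ ≡ γ′
V-faithful {γ = γ} {γ′} dΓ dΔ dγ dγ′ Vγ≈Vγ′ = sub-ext (slen-len dγ) (slen-len dγ′) γ≗γ′
  where
  open ≡-Reasoning
  γ≗γ′ : ∀ {x} → x < len _ → app γ x ≡ app γ′ x
  γ≗γ′ {x} x<n = begin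
    app γ x                                ≡⟨ cong (app γ) (toℕ-fromℕ< x<n) ⟨
    app γ (toℕ (proj₁ c))                  ≡⟨ toℕ-Vmap dΓ dΔ dγ c ⟨
    toℕ (proj₁ (Vmap dΓ dΔ dγ c))          ≡⟨ cong (toℕ ∘ proj₁) (Vγ≈Vγ′ c) ⟩
    toℕ (proj₁ (Vmap dΓ dΔ dγ′ c))         ≡⟨ toℕ-Vmap dΓ dΔ dγ′ c ⟩
    app γ′ (toℕ (proj₁ c))                 ≡⟨ cong (app γ′) (toℕ-fromℕ< x<n) ⟩
    app γ′ x                               ∎
    where c = fromℕ< x<n , refl

module Fullness {Δ Γ : Ctx} (dΓ : Γ ⊢) (dΔ : Δ ⊢) (f : GHom (VG dΓ) (VG dΔ)) where
  open ≡-Reasoning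

  image : ∀ {n} → VCell Γ n → ℕ
  image c = toℕ (proj₁ (map f c))

  image-var : Fin (len Γ) → ℕ
  image-var i = image (i , refl)

  image-var-cell : ∀ {n} (c : VCell Γ n) → image-var (proj₁ c) ≡ image c
  image-var-cell (i , refl) = refl

  image-at : ℕ → ℕ
  image-at x with x <? len Γ
  ... | yes x<n = image-var (fromℕ< x<n)
  ... | no  _   = 0

  image-at-var : (i : Fin (len Γ)) → image-at (toℕ i) ≡ image-var i
  image-at-var i with toℕ i <? len Γ
  ... | yes i<n = cong image-var (fromℕ<-toℕ i i<n)
  ... | no  i≮n = ⊥-elim (i≮n (toℕ<n i))

  γ : Sub
  γ = tabulate image-at (len Γ)

  app-γ : ∀ {n} (c : VCell Γ n) → app γ (toℕ (proj₁ c)) ≡ image c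
  app-γ c = trans (app-tabulate image-at (len Γ) (toℕ<n (proj₁ c)))
                  (trans (image-at-var (proj₁ c)) (image-var-cell c))

  src-image : ∀ {m} (c : VCell Γ (suc m)) → src# (tyAt Δ (image c)) ≡ app γ (src# (tyAt Γ (toℕ (proj₁ c))))
  src-image c = begin
    src# (tyAt Δ (image c))                  ≡⟨ toℕ-src dΔ (map f c) ⟨
    toℕ (proj₁ (Vsrc dΔ (map f c)))          ≡⟨ cong (toℕ ∘ proj₁) (map-s f c) ⟨
    image (Vsrc dΓ c)                        ≡⟨ app-γ (Vsrc dΓ c) ⟨
    app γ (toℕ (proj₁ (Vsrc dΓ c)))          ≡⟨ cong (app γ) (toℕ-src dΓ c) ⟩
    app γ (src# (tyAt Γ (toℕ (proj₁ c))))    ∎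

  tgt-image : ∀ {m} (c : VCell Γ (suc m)) → tgt# (tyAt Δ (image c)) ≡ app γ (tgt# (tyAt Γ (toℕ (proj₁ c))))
  tgt-image c = begin
    tgt# (tyAt Δ (image c))                  ≡⟨ toℕ-tgt dΔ (map f c) ⟨
    toℕ (proj₁ (Vtgt dΔ (map f c)))          ≡⟨ cong (toℕ ∘ proj₁) (map-t f c) ⟨
    image (Vtgt dΓ c)                        ≡⟨ app-γ (Vtgt dΓ c) ⟨
    app γ (toℕ (proj₁ (Vtgt dΓ c)))          ≡⟨ cong (app γ) (toℕ-tgt dΓ c) ⟩
    app γ (tgt# (tyAt Γ (toℕ (proj₁ c))))    ∎

  tyAt-image : ∀ n (c : VCell Γ n) → tyAt Δ (image c) ≡ tyAt Γ (toℕ (proj₁ c)) [ γ ]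
  tyAt-image zero    (i , p) = trans (⋆-η (proj₂ (map f (i , p)))) (sym (cong (_[ γ ]) (⋆-η p)))
  tyAt-image (suc m) (i , p) = begin
    tyAt Δ (image c)                                        ≡⟨ ⇒-η (proj₂ (map f c)) ⟩
    src# T′ ⇒[ base T′ ] tgt# T′                            ≡⟨ ⇒-cong (src-image c) base-image (tgt-image c) ⟩
    app γ (src# T) ⇒[ base T [ γ ] ] app γ (tgt# T)         ≡⟨ cong (_[ γ ]) (⇒-η p) ⟨
    T [ γ ]                                                 ∎
    where
    c  = i , p
    T  = tyAt Γ (toℕ i)
    T′ = tyAt Δ (image c)
    base-image : base T′ ≡ base T [ γ ]
    base-image = begin
      base T′                                  ≡⟨ ty-src dΔ (map f c) ⟨
      tyAt Δ (toℕ (proj₁ (Vsrc dΔ (map f c)))) ≡⟨ cong (tyAt Δ ∘ toℕ ∘ proj₁) (map-s f c) ⟨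
      tyAt Δ (image (Vsrc dΓ c))               ≡⟨ tyAt-image m (Vsrc dΓ c) ⟩
      tyAt Γ (toℕ (proj₁ (Vsrc dΓ c))) [ γ ]   ≡⟨ cong (_[ γ ]) (ty-src dΓ c) ⟩
      base T [ γ ]                             ∎

  dγ : Δ ⊢s γ ⦂ Γ
  dγ = ⊢s-intro dΔ dΓ (slen-tabulate _ _) typed
    where
    typed : ∀ {x A} → Γ ∋ x ⦂ A → Δ ⊢ app γ x ⦂ (A [ γ ])
    typed m with fromℕ< (proj₁ (∋⇒tyAt m)) | toℕ-fromℕ< (proj₁ (∋⇒tyAt m))
    ... | i | refl = subst₂ (Δ ⊢_⦂_) (sym (app-γ c))
                       (trans (tyAt-image _ c) (cong (_[ γ ]) (proj₂ (∋⇒tyAt m))))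
                       (var⊢ dΔ (tyAt⇒∋ (toℕ<n (proj₁ (map f c)))))
      where c = i , refl

  Vγ≈f : V₁ dΓ dΔ dγ ≈G f
  Vγ≈f c = VCell-≡ (trans (toℕ-Vmap dΓ dΔ dγ c) (app-γ c))

V-full : ∀ {Δ Γ} (dΓ : Γ ⊢) (dΔ : Δ ⊢) (f : GHom (gset (V₀ Γ dΓ)) (gset (V₀ Δ dΔ))) →
         Σ[ γ ∈ Sub ] Σ[ dγ ∈ Δ ⊢s γ ⦂ Γ ] (V₁ dΓ dΔ dγ ≈G f)
V-full dΓ dΔ f = γ , dγ , Vγ≈f
  where open Fullness dΓ dΔ f

argmin : ∀ n (f : Fin (suc n) → ℕ) → Σ[ m ∈ Fin (suc n) ] (∀ i → f m ≤ f i)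
argmin zero    f = fz , λ { fz → ≤-refl }
argmin (suc n) f with argmin n (f ∘ fs)
... | m , m-min with f fz ≤? f (fs m)
...   | yes f0≤fm = fz , λ { fz → ≤-refl ; (fs i) → ≤-trans f0≤fm (m-min i) }
...   | no  f0≰fm = fs m , λ { fz → <⇒≤ (≰⇒> f0≰fm) ; (fs i) → m-min i }

SortedBy : ∀ {n} → (Fin n → ℕ) → Permutation′ n → Set
SortedBy key π = ∀ i j → key (π ⟨$⟩ʳ i) < key (π ⟨$⟩ʳ j) → i Fin.< j

sortBy : ∀ n (key : Fin n → ℕ) → Σ[ π ∈ Permutation′ n ] SortedBy key π
sortBy zero    key = id , λ ()
sortBy (suc n) key = insert fz m (proj₁ rest) , sorted
  where
  m     = proj₁ (argmin n key)
  m-min = proj₂ (argmin n key)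
  rest  = sortBy n (key ∘ punchIn m)
  sorted : SortedBy key (insert fz m (proj₁ rest))
  sorted fz     fz     k<k = ⊥-elim (<-irrefl refl k<k)
  sorted fz     (fs j) _   = s≤s z≤n
  sorted (fs i) fz     k<m = ⊥-elim (<-irrefl refl (<-≤-trans k<m (m-min _)))
  sorted (fs i) (fs j) k<k = s≤s (proj₂ rest i j k<k)

module _ {P : ℕ → Set} where
  fibre : ∀ {n} (y : Σ ℕ P) → proj₁ y ≡ n → P n
  fibre (_ , c) refl = c

  fibre-η : ∀ {n} (y : Σ ℕ P) (eq : proj₁ y ≡ n) → (n , fibre y eq) ≡ y
  fibre-η _ refl = refl

  fibre-β : ∀ {n} (y : Σ ℕ P) (eq : proj₁ y ≡ n) {c : P n} → y ≡ (n , c) → fibre y eq ≡ c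
  fibre-β _ eq refl with ≡-irrelevant eq refl
  ... | refl = refl

-- The context realising G: its i-th variable is the i-th cell, so cells are named by position.
module Realisation (G : GSet) {N : ℕ} (e : Fin N ↔ Σ ℕ (Cell G))
                   (sorted : ∀ i j → proj₁ (Inverse.to e i) < proj₁ (Inverse.to e j) → i Fin.< j) where
  open Inverse e using (to; from; strictlyInverseˡ; strictlyInverseʳ)

  name : ∀ {n} → Cell G n → ℕ
  name {n} c = toℕ (from (n , c))

  name-mono : ∀ {m n} (b : Cell G m) (c : Cell G n) → m < n → name b < name c
  name-mono {m} {n} b c =
    sorted _ _ ∘ subst₂ (λ y z → proj₁ y < proj₁ z) (sym (strictlyInverseˡ (m , b))) (sym (strictlyInverseˡ (n , c)))

  cellType : ∀ n → Cell G n → Ty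
  cellType zero    c = ⋆
  cellType (suc n) c = name (src G c) ⇒[ cellType n (src G c) ] name (tgt G c)

  dim-cellType : ∀ n (c : Cell G n) → dim⁺ (cellType n c) ≡ n
  dim-cellType zero    c = refl
  dim-cellType (suc n) c = cong suc (dim-cellType n (src G c))

  cellType-src≡tgt : ∀ n (c : Cell G (suc n)) → cellType n (src G c) ≡ cellType n (tgt G c)
  cellType-src≡tgt zero    c = refl
  cellType-src≡tgt (suc n) c =
    ⇒-cong (cong name (ss≡st G c)) (cong (cellType n) (ss≡st G c)) (cong name (ts≡tt G c))

  entry : Fin N → Ty
  entry i = cellType (proj₁ (to i)) (proj₂ (to i))

  entry-from : ∀ {n} (c : Cell G n) → entry (from (n , c)) ≡ cellType n c
  entry-from c = cong (λ y → cellType (proj₁ y) (proj₂ y)) (strictlyInverseˡ (_ , c))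

  -- The bound is irrelevant, so prefixes built from different proofs of it coincide definitionally.
  prefix : ∀ j → .(j ≤ N) → Ctx
  prefix zero    _   = ∅
  prefix (suc j) j<N = prefix j (<⇒≤ j<N) ▸ entry (fromℕ< j<N)

  len-prefix : ∀ j .(j≤N : j ≤ N) → len (prefix j j≤N) ≡ j
  len-prefix zero    _   = refl
  len-prefix (suc j) j<N = cong suc (len-prefix j (<⇒≤ j<N))

  prefix-∋ : ∀ j .(j≤N : j ≤ N) {x} (x<j : x < j) → prefix j j≤N ∋ x ⦂ entry (fromℕ< (<-≤-trans x<j j≤N))
  prefix-∋ (suc j) j<N x<1+j with m<1+n⇒m<n∨m≡n x<1+j
  ... | inj₁ x<j  = there (prefix-∋ j (<⇒≤ j<N) x<j)
  ... | inj₂ refl = subst (λ y → prefix (suc j) j<N ∋ y ⦂ entry (fromℕ< j<N)) (len-prefix j (<⇒≤ j<N)) here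

  name-∋ : ∀ {j} .(j≤N : j ≤ N) {n} (c : Cell G n) → name c < j → prefix j j≤N ∋ name c ⦂ cellType n c
  name-∋ j≤N c c<j =
    subst (prefix _ j≤N ∋ name c ⦂_) (trans (cong entry (fromℕ<-toℕ _ _)) (entry-from c)) (prefix-∋ _ j≤N c<j)

  cellType-⊢ : ∀ {j} .(j≤N : j ≤ N) → prefix j j≤N ⊢ → ∀ n (c : Cell G n) → name c ≤ j →
               prefix j j≤N ⊢ty cellType n c
  cellType-⊢ j≤N dΓ zero    c _   = ⋆⊢ dΓ
  cellType-⊢ j≤N dΓ (suc n) c c≤j =
    ⇒⊢ (cellType-⊢ j≤N dΓ n (src G c) (<⇒≤ s<j))
       (var⊢ dΓ (name-∋ j≤N (src G c) s<j))
       (subst (_ ⊢ name (tgt G c) ⦂_) (sym (cellType-src≡tgt n c)) (var⊢ dΓ (name-∋ j≤N (tgt G c) t<j)))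
    where
    s<j = <-≤-trans (name-mono (src G c) c (n<1+n n)) c≤j
    t<j = <-≤-trans (name-mono (tgt G c) c (n<1+n n)) c≤j

  prefix-⊢ : ∀ j .(j≤N : j ≤ N) → prefix j j≤N ⊢
  prefix-⊢ zero    _   = ∅⊢
  prefix-⊢ (suc j) j<N = ▸⊢ (cellType-⊢ _ (prefix-⊢ j (<⇒≤ j<N)) _ _ i≤j)
    where
    i≤j : name (proj₂ (to (fromℕ< j<N))) ≤ j
    i≤j = ≤-reflexive (trans (cong toℕ (strictlyInverseʳ _)) (toℕ-fromℕ< j<N))

  Γ : Ctx
  Γ = prefix N ≤-refl

  dΓ : Γ ⊢
  dΓ = prefix-⊢ N ≤-refl

  <len-Γ : ∀ {x} → x < N → x < len Γ
  <len-Γ = subst (_ <_) (sym (len-prefix N ≤-refl))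

  tyAt-name : ∀ {n} (c : Cell G n) → tyAt Γ (name c) ≡ cellType n c
  tyAt-name c = proj₂ (∋⇒tyAt (name-∋ ≤-refl c (toℕ<n _)))

  toℕ<N : (i : Fin (len Γ)) → toℕ i < N
  toℕ<N i = subst (toℕ i <_) (len-prefix N ≤-refl) (toℕ<n i)

  cellIndex : Fin (len Γ) → Fin N
  cellIndex i = fromℕ< (toℕ<N i)

  dim-cellIndex : ∀ {n} (x : VCell Γ n) → proj₁ (to (cellIndex (proj₁ x))) ≡ n
  dim-cellIndex (i , p) =
    trans (sym (dim-cellType _ _)) (trans (cong dim⁺ (sym (proj₂ (∋⇒tyAt (prefix-∋ N ≤-refl (toℕ<N i)))))) p)

  toCell : ∀ {n} → VCell Γ n → Cell G n
  toCell x = fibre (to (cellIndex (proj₁ x))) (dim-cellIndex x)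

  fromCell : ∀ {n} → Cell G n → VCell Γ n
  fromCell {n} c = fromℕ< name<len ,
    trans (cong (dim⁺ ∘ tyAt Γ) (toℕ-fromℕ< name<len)) (trans (cong dim⁺ (tyAt-name c)) (dim-cellType n c))
    where name<len = <len-Γ (toℕ<n (from (n , c)))

  toℕ-fromCell : ∀ {n} (c : Cell G n) → toℕ (proj₁ (fromCell c)) ≡ name c
  toℕ-fromCell c = toℕ-fromℕ< _

  toCell-fromCell : ∀ {n} (c : Cell G n) → toCell (fromCell c) ≡ c
  toCell-fromCell {n} c = fibre-β (to (cellIndex (proj₁ (fromCell c)))) (dim-cellIndex (fromCell c))
    (trans (cong to (toℕ-injective (trans (toℕ-fromℕ< _) (toℕ-fromCell c)))) (strictlyInverseˡ (n , c)))

  fromCell-toCell : ∀ {n} (x : VCell Γ n) → fromCell (toCell x) ≡ x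
  fromCell-toCell (i , p) = VCell-≡ (begin
    toℕ (proj₁ (fromCell (toCell (i , p))))   ≡⟨ toℕ-fromCell _ ⟩
    toℕ (from (_ , toCell (i , p)))           ≡⟨ cong (toℕ ∘ from) (fibre-η (to (cellIndex i)) (dim-cellIndex (i , p))) ⟩
    toℕ (from (to (fromℕ< _)))                ≡⟨ cong toℕ (strictlyInverseʳ _) ⟩
    toℕ (fromℕ< _)                            ≡⟨ toℕ-fromℕ< _ ⟩
    toℕ i                                     ∎)
    where open ≡-Reasoning

  fromCell-src : ∀ {n} (c : Cell G (suc n)) → fromCell (src G c) ≡ Vsrc dΓ (fromCell c)
  fromCell-src c = VCell-≡ (trans (toℕ-fromCell (src G c)) (sym
    (trans (toℕ-src dΓ (fromCell c)) (cong src# (trans (cong (tyAt Γ) (toℕ-fromCell c)) (tyAt-name c))))))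

  fromCell-tgt : ∀ {n} (c : Cell G (suc n)) → fromCell (tgt G c) ≡ Vtgt dΓ (fromCell c)
  fromCell-tgt c = VCell-≡ (trans (toℕ-fromCell (tgt G c)) (sym
    (trans (toℕ-tgt dΓ (fromCell c)) (cong tgt# (trans (cong (tyAt Γ) (toℕ-fromCell c)) (tyAt-name c))))))

  fromHom : GHom G (VG dΓ)
  fromHom = record { map = fromCell ; map-s = fromCell-src ; map-t = fromCell-tgt }

  toHom : GHom (VG dΓ) G
  toHom = record
    { map   = toCell
    ; map-s = λ x → trans (cong (toCell ∘ Vsrc dΓ) (sym (fromCell-toCell x)))
                          (trans (cong toCell (sym (fromCell-src (toCell x)))) (toCell-fromCell _))
    ; map-t = λ x → trans (cong (toCell ∘ Vtgt dΓ) (sym (fromCell-toCell x)))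
                          (trans (cong toCell (sym (fromCell-tgt (toCell x)))) (toCell-fromCell _))
    }

  VΓ≅G : GIso (VG dΓ) G
  VΓ≅G = record { to = toHom ; from = fromHom ; from∘to = fromCell-toCell ; to∘from = toCell-fromCell }

V-essentiallySurjective : (G : FinGSet) → Σ[ Γ ∈ Ctx ] Σ[ dΓ ∈ Γ ⊢ ] GIso (gset (V₀ Γ dΓ)) (gset G)
V-essentiallySurjective G = Γ , dΓ , VΓ≅G
  where
  N = proj₁ (finite G)
  e = proj₂ (finite G)
  byDim = sortBy N (proj₁ ∘ Inverse.to e)
  open Realisation (gset G) (e ↔-∘ proj₁ byDim) (proj₂ byDim)

theorem2p9 : SynCategory&VFunctor × VIsEquivalence
theorem2p9 = synCategory&V , record
  { faithful = V-faithful
  ; full     = V-full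
  ; ess-surj = V-essentiallySurjective
  }
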